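{- Let $n\ge 4$ and let $D_n$ be the tree on vertex set $\{1,\ldots,n\}$ with edges $\{1,3\},\{2,3\}$ and $\{i,i+1\}$ for $3\le i\le n-1$, with adjacency matrix $A$; let $W(D_n)=[e_n,Ae_n,\ldots,A^{n-1}e_n]$ and let $\hat W(D_n)$ be obtained from $W(D_n)$ by deleting its first row and last column. Let $B$ be the $(n-1)\times(n-1)$ tridiagonal matrix with zero diagonal, superdiagonal entries all equal to $1$, and subdiagonal entries $B_{2,1}=2$ and $B_{i+1,i}=1$ for $2\le i\le n-2$. Then $\hat W(D_n)=W(B)$, where $W(B)=[e_{n-1},Be_{n-1},\ldots,B^{n-2}e_{n-1}]$.
   Context: $e_m$ denotes the all-ones vector of length $m$; for an $m\times m$ matrix $M$, $W(M)=[e_m,Me_m,\ldots,M^{m-1}e_m]$. -}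

module Defs where

open import Data.Nat using (ℕ; zero; suc; _+_; _*_; _≤_)
open import Data.Fin using (Fin; toℕ)
open import Data.Bool using (Bool; true; false; if_then_else_; _∧_; _∨_)
open import Data.Nat using (_≡ᵇ_; _≤ᵇ_)

Matrix : ℕ → Set
Matrix m = Fin m → Fin m → ℕ

sumFin : ∀ {m} → (Fin m → ℕ) → ℕ
sumFin {zero}  f = 0
sumFin {suc m} f = f Data.Fin.zero + sumFin (λ k → f (Data.Fin.suc k))

_·ᵥ_ : ∀ {m} → Matrix m → (Fin m → ℕ) → (Fin m → ℕ)
(M ·ᵥ v) i = sumFin (λ k → M i k * v k)

-- all-ones vector e_m
ones : ∀ {m} → Fin m → ℕ
ones _ = 1

powOnes : ∀ {m} → Matrix m → ℕ → (Fin m → ℕ)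
powOnes M zero    = ones
powOnes M (suc k) = M ·ᵥ powOnes M k

W : ∀ {m} → Matrix m → Matrix m
W M i j = powOnes M (toℕ j) i

𝟙 : Bool → ℕ
𝟙 true  = 1
𝟙 false = 0

-- Adjacency matrix of the tree D_n, vertices 1..n stored as Fin n (vertex v ↦ index v-1).
-- Edges {1,3}, {2,3}, {i,i+1} (3 ≤ i ≤ n-1); in 0-indexed terms:
-- {0,2}, {1,2}, {a,a+1} for 2 ≤ a.
Dedge : ℕ → ℕ → Bool
Dedge a b = ((a ≡ᵇ 0) ∧ (b ≡ᵇ 2)) ∨ ((a ≡ᵇ 1) ∧ (b ≡ᵇ 2))
          ∨ ((2 ≤ᵇ a) ∧ (b ≡ᵇ suc a))

adjD : (n : ℕ) → Matrix n
adjD n i j = 𝟙 (Dedge (toℕ i) (toℕ j) ∨ Dedge (toℕ j) (toℕ i))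

-- The (n-1)×(n-1) tridiagonal matrix B (here of size m = n-1), 0-indexed:
-- B i (i+1) = 1 (superdiagonal), B 1 0 = 2, B (i+1) i = 1 for 1 ≤ i, all else 0.
Bent : ℕ → ℕ → ℕ
Bent a b =
  if b ≡ᵇ suc a then 1
  else if (a ≡ᵇ 1) ∧ (b ≡ᵇ 0) then 2
  else if (1 ≤ᵇ b) ∧ (a ≡ᵇ suc b) then 1
  else 0

Bmat : (m : ℕ) → Matrix m
Bmat m i j = Bent (toℕ i) (toℕ j)

-- Ŵ(D_n) for n = suc m: delete first row and last column of W(D_n).
What : (m : ℕ) → Matrix m
What m i j = W (adjD (suc m)) (Data.Fin.suc i) (Data.Fin.inject₁ j)

-- Vertices 1 and 2 of D_n are twins (both adjacent to vertex 3 only), so every A^k e_n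
-- has equal first two entries. Deleting the first entry therefore intertwines A with the
-- matrix B obtained by merging column 1 into column 2, which is the given B: its only
-- entry 2 is the doubled edge {2,3}.
module Submission where

open import Defs
open import Data.Nat using (ℕ; zero; suc; _+_; _*_; _≤_; _≡ᵇ_)
open import Data.Nat.Properties using (*-distribʳ-+; +-assoc)
open import Data.Bool using (true; false; _∨_)
open import Data.Fin using (Fin; toℕ; inject₁) renaming (zero to fz; suc to fs)
open import Data.Fin.Properties using (toℕ-inject₁)
open import Function using (_∘_)
open import Relation.Binary.PropositionalEquality

sumFin-cong : ∀ {m} {f g : Fin m → ℕ} → f ≗ g → sumFin f ≡ sumFin g
sumFin-cong {zero}  f≗g = refl
sumFin-cong {suc m} f≗g = cong₂ _+_ (f≗g fz) (sumFin-cong (f≗g ∘ fs))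

·ᵥ-cong : ∀ {m} (M : Matrix m) {v w : Fin m → ℕ} → v ≗ w → M ·ᵥ v ≗ M ·ᵥ w
·ᵥ-cong M v≗w i = sumFin-cong (λ k → cong (M i k *_) (v≗w k))

adj : ℕ → ℕ → ℕ
adj a b = 𝟙 (Dedge a b ∨ Dedge b a)

adj-twins : ∀ b → adj 0 b ≡ adj 1 b
adj-twins zero                = refl
adj-twins (suc zero)          = refl
adj-twins (suc (suc zero))    = refl
adj-twins (suc (suc (suc b))) = refl

Bent-zero : ∀ a → Bent a 0 ≡ adj (suc a) 0 + adj (suc a) 1
Bent-zero zero          = refl
Bent-zero (suc zero)    = refl
Bent-zero (suc (suc a)) = refl

Bent-suc : ∀ a b → Bent a (suc b) ≡ adj (suc a) (suc (suc b))
Bent-suc zero                zero          = refl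
Bent-suc zero                (suc b)       = refl
Bent-suc (suc zero)          zero          = refl
Bent-suc (suc zero)          (suc zero)    = refl
Bent-suc (suc zero)          (suc (suc b)) = refl
Bent-suc (suc (suc zero))    zero          = refl
Bent-suc (suc (suc (suc a))) zero          = refl
Bent-suc (suc (suc a))       (suc b) with b ≡ᵇ suc a | a ≡ᵇ suc b
... | true  | _     = refl
... | false | true  = refl
... | false | false = refl

dupHead : ∀ {m} → (Fin (suc m) → ℕ) → (Fin (suc (suc m)) → ℕ)
dupHead y fz     = y fz
dupHead y (fs i) = y i

adjD-row-twins : ∀ {m} (v : Fin (suc (suc m)) → ℕ) →
                 (adjD (suc (suc m)) ·ᵥ v) fz ≡ (adjD (suc (suc m)) ·ᵥ v) (fs fz)
adjD-row-twins v = sumFin-cong (λ k → cong (_* v k) (adj-twins (toℕ k)))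

adjD-·ᵥ-dupHead : ∀ {m} (y : Fin (suc m) → ℕ) →
                  adjD (suc (suc m)) ·ᵥ dupHead y ≗ dupHead (Bmat (suc m) ·ᵥ y)
adjD-·ᵥ-dupHead y fz     = trans (adjD-row-twins (dupHead y)) (adjD-·ᵥ-dupHead y (fs fz))
adjD-·ᵥ-dupHead y (fs i) = begin
  adj a 0 * y fz + (adj a 1 * y fz + rest)  ≡⟨ sym (+-assoc (adj a 0 * y fz) (adj a 1 * y fz) rest) ⟩
  adj a 0 * y fz + adj a 1 * y fz + rest    ≡⟨ cong (_+ rest) (sym (*-distribʳ-+ (y fz) (adj a 0) (adj a 1))) ⟩
  (adj a 0 + adj a 1) * y fz + rest         ≡⟨ cong₂ (λ c s → c * y fz + s) (sym (Bent-zero (toℕ i)))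
                                                      (sumFin-cong (λ k → cong (_* y (fs k)) (sym (Bent-suc (toℕ i) (toℕ k))))) ⟩
  (Bmat _ ·ᵥ y) i                           ∎
  where
  open ≡-Reasoning
  a = suc (toℕ i)
  rest = sumFin (λ k → adj a (suc (suc (toℕ k))) * y (fs k))

powOnes-adjD : ∀ m k → powOnes (adjD (suc (suc m))) k ≗ dupHead (powOnes (Bmat (suc m)) k)
powOnes-adjD m zero    fz     = refl
powOnes-adjD m zero    (fs i) = refl
powOnes-adjD m (suc k) i      = trans (·ᵥ-cong (adjD _) (powOnes-adjD m k) i)
                                      (adjD-·ᵥ-dupHead (powOnes (Bmat (suc m)) k) i)

lemma2p1 : (m : ℕ) → 4 ≤ suc m →
    (i j : Fin m) → What m i j ≡ W (Bmat m) i j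
lemma2p1 (suc m) _ i j = begin
  powOnes (adjD (suc (suc m))) (toℕ (inject₁ j)) (fs i)  ≡⟨ cong (λ k → powOnes (adjD _) k (fs i)) (toℕ-inject₁ j) ⟩
  powOnes (adjD (suc (suc m))) (toℕ j) (fs i)            ≡⟨ powOnes-adjD m (toℕ j) (fs i) ⟩
  powOnes (Bmat (suc m)) (toℕ j) i                       ∎
  where open ≡-Reasoning
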